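{- Let $(\Sigma,d)$ be a metric space in which every non-zero distance is at least $1$, and let $x,y$ be strings over $\Sigma$. For all admissible $r_x,r_y,o_y$, $$\operatorname{SP}(x,y,r_x,r_y,o_y)\ \ge\ \frac{|r_x-r_y|-1}{2}.$$
   Context: Runs of a string are its maximal blocks of consecutive equal letters, numbered $1,2,\dots$ from left to right. An expansion of a string is obtained by replacing runs with longer runs of the same letter ("extending" them). A correspondence between strings $u$ and $v$ is a pair of equal-length expansions $(\overline{u},\overline{v})$; its cost is $\sum_i d(\overline{u}_i,\overline{v}_i)$. A run is extended in a correspondence if its length in the expansion exceeds its original length. Admissible parameters: integers $r_x$ between $0$ and the number of runs of $x$, $r_y$ between $0$ and the number of runs of $y$, and $o_y$ between $0$ and the length of the $r_y$-th run of $y$ (with $o_y=0$ if $r_y=0$). Let $x'$ consist of the first $r_x$ runs of $x$ and $y'$ consist of the first $r_y-1$ runs of $y$ followed by the first $o_y$ letters of the $r_y$-th run of $y$. Then $\operatorname{SP}(x,y,r_x,r_y,o_y)$ is the minimum cost of a correspondence between $x'$ and $y'$ in which the $r_y$-th run of $y'$ (its final $o_y$ letters) is not extended, and is $\infty$ if no such correspondence exists.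
   Formalization: The metric $d$ on $\Sigma$ takes rational values. -}

module Defs where

open import Data.Nat as ℕ using (ℕ; zero; suc; _∸_; ∣_-_∣)
open import Data.Integer using (+_)
open import Data.Rational using (ℚ; 0ℚ; 1ℚ; ½; _+_; _-_; _*_; _/_; _≤_; _≟_)
open import Data.List using (List; []; _∷_; _++_; replicate; concatMap; take; length; zipWith; foldr)
open import Data.List.Relation.Binary.Pointwise using (Pointwise)
open import Data.Maybe using (Maybe; just; nothing)
open import Data.Product using (Σ; _×_; _,_; proj₁; proj₂)
open import Relation.Binary.PropositionalEquality using (_≡_; _≢_; refl; sym; trans; cong)
open import Relation.Nullary using (yes; no; Dec)
open import Relation.Nullary.Decidable using (map′)

record MetricSpace : Set₁ where
  field
    Carrier : Set
    d       : Carrier → Carrier → ℚ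
    d-refl  : ∀ a → d a a ≡ 0ℚ
    d-zero  : ∀ a b → d a b ≡ 0ℚ → a ≡ b
    d-sym   : ∀ a b → d a b ≡ d b a
    d-tri   : ∀ a b c → d a c ≤ d a b + d b c

at : ∀ {B : Set} → ℕ → List B → Maybe B
at _       []       = nothing
at zero    (b ∷ _)  = just b
at (suc i) (_ ∷ bs) = at i bs

module Strings (M : MetricSpace) where
  open MetricSpace M public

  _≟Σ_ : ∀ (a b : Carrier) → Dec (a ≡ b)
  a ≟Σ b = map′ (d-zero a b) (λ { refl → d-refl a }) (d a b ≟ 0ℚ)

  Run : Set
  Run = Carrier × ℕ   -- (letter, length)

  runs : List Carrier → List Run
  runs [] = []
  runs (a ∷ s) with runs s
  ... | [] = (a , 1) ∷ []
  ... | (b , n) ∷ rs with a ≟Σ b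
  ...   | yes _ = (b , suc n) ∷ rs
  ...   | no  _ = (a , 1) ∷ (b , n) ∷ rs

  decode : List Run → List Carrier
  decode = concatMap (λ r → replicate (proj₂ r) (proj₁ r))

  -- a run-list es describes an expansion of u: same letters, each run at least as long
  ExtendsRuns : List Run → List Run → Set
  ExtendsRuns = Pointwise (λ r e → proj₁ r ≡ proj₁ e × proj₂ r ℕ.≤ proj₂ e)

  -- A correspondence between u and v: equal-length expansions, given by their run lists.
  record Correspondence (u v : List Carrier) : Set where
    field
      eu  : List Run
      ev  : List Run
      eu-ext : ExtendsRuns (runs u) eu
      ev-ext : ExtendsRuns (runs v) ev
      same-length : length (decode eu) ≡ length (decode ev)
    ubar : List Carrier
    ubar = decode eu
    vbar : List Carrier
    vbar = decode ev

  cost : ∀ {u v} → Correspondence u v → ℚ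
  cost c = foldr _+_ 0ℚ (zipWith d (Correspondence.ubar c) (Correspondence.vbar c))

  -- The run of v with 0-based index i is not extended in the correspondence c
  -- (vacuous if v has no such run).
  NotExtendedᵥ : ∀ {u v} → ℕ → Correspondence u v → Set
  NotExtendedᵥ {v = v} i c =
    ∀ r e → at i (runs v) ≡ just r → at i (Correspondence.ev c) ≡ just e → proj₂ e ≡ proj₂ r

  Admissible : List Carrier → List Carrier → ℕ → ℕ → ℕ → Set
  Admissible x y rx zero oy = rx ℕ.≤ length (runs x) × oy ≡ 0
  Admissible x y rx (suc r) oy =
    rx ℕ.≤ length (runs x) × suc r ℕ.≤ length (runs y) ×
    (∀ e → at r (runs y) ≡ just e → oy ℕ.≤ proj₂ e)

  xPrefix : List Carrier → ℕ → List Carrier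
  xPrefix x rx = decode (take rx (runs x))

  yPrefix : List Carrier → ℕ → ℕ → List Carrier
  yPrefix y zero oy = []
  yPrefix y (suc r) oy = decode (take r (runs y)) ++ lastPart (at r (runs y))
    where
    lastPart : Maybe Run → List Carrier
    lastPart (just e) = replicate oy (proj₁ e)
    lastPart nothing  = []

  bound : ℕ → ℕ → ℚ
  bound rx ry = ((+ ∣ rx - ry ∣) / 1 - 1ℚ) * ½

{-# OPTIONS --safe #-}
module Submission where

-- Two equal-length strings that disagree in m positions have numbers of runs differing by at
-- most 2m, since a mismatch at position i can only create or destroy the run boundaries
-- between i-1 and i and between i and i+1. Extending runs preserves the number of runs, x'
-- has r_x runs and y' has r_y or r_y - 1 runs, so the two expansions of a correspondence
-- mismatch in some m positions with |r_x - r_y| <= 2m + 1, while every mismatch costs at least 1.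

open import Data.Nat as ℕ using (ℕ; zero; suc; _+_; _*_; _∸_; z≤n; s≤s; ∣_-_∣)
open import Data.Nat.Solver using (module +-*-Solver)
open import Data.List using (List; []; _∷_; _++_; map; replicate; length; take; foldr; zipWith)
open import Data.List.Relation.Binary.Pointwise as Pointwise using ([]; _∷_; Pointwise-≡⇒≡)
open import Data.List.Relation.Unary.All using (All; []; _∷_)
import Data.List.Relation.Unary.All.Properties as All
open import Data.List.Relation.Unary.Linked using (Linked; []; [-]; _∷_)
import Data.List.Relation.Unary.Linked.Properties as Linked
import Data.List.Properties as List
open import Data.Maybe using (just; nothing)
open import Data.Product using (_×_; _,_; proj₁)
open import Function using (_on_)
open import Relation.Binary.Definitions using (DecidableEquality)
open import Relation.Binary.PropositionalEquality using (_≡_; _≢_; refl; sym; trans; cong; cong₂; subst; subst₂; module ≡-Reasoning)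
open import Relation.Nullary using (Dec; yes; no; contradiction)
open import Defs

Linked-take⁺ : ∀ {a ℓ} {A : Set a} {R : A → A → Set ℓ} n {xs : List A} →
               Linked R xs → Linked R (take n xs)
Linked-take⁺ zero          _       = []
Linked-take⁺ (suc n)       []      = []
Linked-take⁺ (suc zero)    [-]     = [-]
Linked-take⁺ (suc zero)    (_ ∷ _) = [-]
Linked-take⁺ (suc (suc n)) [-]     = [-]
Linked-take⁺ (suc (suc n)) (r ∷ l) = r ∷ Linked-take⁺ (suc n) l

m≤n+o∧n≤m+o⇒∣m-n∣≤o : ∀ {m n o} → m ℕ.≤ n + o → n ℕ.≤ m + o → ∣ m - n ∣ ℕ.≤ o
m≤n+o∧n≤m+o⇒∣m-n∣≤o {zero}              _           n≤o         = n≤o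
m≤n+o∧n≤m+o⇒∣m-n∣≤o {suc m} {zero}      m≤o         _           = m≤o
m≤n+o∧n≤m+o⇒∣m-n∣≤o {suc m} {suc n} (s≤s m≤n+o) (s≤s n≤m+o) = m≤n+o∧n≤m+o⇒∣m-n∣≤o m≤n+o n≤m+o

module RunCount {a} {A : Set a} (_≟_ : DecidableEquality A) where

  open import Data.Nat using (_≤_)
  open import Data.Nat.Properties hiding (_≟_)

  δ : A → A → ℕ
  δ a b with a ≟ b
  ... | yes _ = 0
  ... | no  _ = 1

  δ-refl : ∀ a → δ a a ≡ 0
  δ-refl a with a ≟ a
  ... | yes _  = refl
  ... | no a≢a = contradiction refl a≢a

  δ-≢ : ∀ {a b} → a ≢ b → δ a b ≡ 1
  δ-≢ {a} {b} a≢b with a ≟ b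
  ... | yes a≡b = contradiction a≡b a≢b
  ... | no  _   = refl

  δ≤1 : ∀ a b → δ a b ≤ 1
  δ≤1 a b with a ≟ b
  ... | yes _ = z≤n
  ... | no  _ = s≤s z≤n

  δ-sym : ∀ a b → δ a b ≡ δ b a
  δ-sym a b with a ≟ b
  ... | yes refl = sym (δ-refl a)
  ... | no  a≢b  = sym (δ-≢ (λ b≡a → a≢b (sym b≡a)))

  δ-triangle : ∀ a b c → δ a c ≤ δ a b + δ b c
  δ-triangle a b c with a ≟ b | b ≟ c
  ... | yes refl | yes refl = ≤-reflexive (δ-refl a)
  ... | yes _    | no  _    = δ≤1 a c
  ... | no  _    | _        = ≤-trans (δ≤1 a c) (m≤m+n 1 _)

  δ-quadrangle : ∀ a a′ b b′ → δ a a′ ≤ δ a b + δ b b′ + δ a′ b′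
  δ-quadrangle a a′ b b′ = begin
    δ a a′                        ≤⟨ δ-triangle a b a′ ⟩
    δ a b + δ b a′                ≤⟨ +-monoʳ-≤ (δ a b) (δ-triangle b b′ a′) ⟩
    δ a b + (δ b b′ + δ b′ a′)    ≡⟨ cong (λ n → δ a b + (δ b b′ + n)) (δ-sym b′ a′) ⟩
    δ a b + (δ b b′ + δ a′ b′)    ≡⟨ +-assoc (δ a b) _ _ ⟨
    δ a b + δ b b′ + δ a′ b′      ∎
    where open ≤-Reasoning

  changes : A → List A → ℕ
  changes a []      = 0
  changes a (b ∷ s) = δ a b + changes b s

  runCount : List A → ℕ
  runCount []      = 0
  runCount (a ∷ s) = suc (changes a s)

  mismatches : List A → List A → ℕ
  mismatches (a ∷ s) (b ∷ t) = δ a b + mismatches s t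
  mismatches _       _       = 0

  mismatches-comm : ∀ s t → mismatches s t ≡ mismatches t s
  mismatches-comm []      []      = refl
  mismatches-comm []      (_ ∷ _) = refl
  mismatches-comm (_ ∷ _) []      = refl
  mismatches-comm (a ∷ s) (b ∷ t) = cong₂ _+_ (δ-sym a b) (mismatches-comm s t)

  changes-≤ : ∀ a b s t → length s ≡ length t →
              changes a s ≤ δ a b + changes b t + 2 * mismatches s t
  changes-≤ a b []       []       _  = z≤n
  changes-≤ a b (a′ ∷ s) (b′ ∷ t) eq = begin
    δ a a′ + changes a′ s
      ≤⟨ +-mono-≤ (δ-quadrangle a a′ b b′) (changes-≤ a′ b′ s t (suc-injective eq)) ⟩
    (δ a b + δ b b′ + δ a′ b′) + (δ a′ b′ + changes b′ t + 2 * mismatches s t)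
      ≡⟨ solve 5 (λ p q r u v → (p :+ q :+ r) :+ (r :+ u :+ con 2 :* v)
                              := p :+ (q :+ u) :+ con 2 :* (r :+ v))
               refl (δ a b) (δ b b′) (δ a′ b′) (changes b′ t) (mismatches s t) ⟩
    δ a b + (δ b b′ + changes b′ t) + 2 * (δ a′ b′ + mismatches s t) ∎
    where open ≤-Reasoning
          open +-*-Solver

  runCount-≤ : ∀ s t → length s ≡ length t → runCount s ≤ runCount t + 2 * mismatches s t
  runCount-≤ []      []      _  = z≤n
  runCount-≤ (a ∷ s) (b ∷ t) eq = s≤s (begin
    changes a s                                    ≤⟨ changes-≤ a b s t (suc-injective eq) ⟩
    δ a b + changes b t + 2 * mismatches s t       ≤⟨ +-monoˡ-≤ _ (+-monoˡ-≤ (changes b t) (m≤m+n (δ a b) _)) ⟩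
    2 * δ a b + changes b t + 2 * mismatches s t   ≡⟨ solve 3 (λ p u v → con 2 :* p :+ u :+ con 2 :* v
                                                               := u :+ con 2 :* (p :+ v))
                                                        refl (δ a b) (changes b t) (mismatches s t) ⟩
    changes b t + 2 * (δ a b + mismatches s t)     ∎)
    where open ≤-Reasoning
          open +-*-Solver

  changes-replicate : ∀ a n → changes a (replicate n a) ≡ 0
  changes-replicate a zero    = refl
  changes-replicate a (suc n) rewrite δ-refl a = changes-replicate a n

  changes-replicate-++ : ∀ a n s → changes a (replicate n a ++ s) ≡ changes a s
  changes-replicate-++ a zero    s = refl
  changes-replicate-++ a (suc n) s rewrite δ-refl a = changes-replicate-++ a n s

  runCount-replicate : ∀ a n → runCount (replicate n a) ≤ 1
  runCount-replicate a zero    = z≤n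
  runCount-replicate a (suc n) = s≤s (≤-reflexive (changes-replicate a n))

  changes-++-≥ : ∀ a p q → changes a p ≤ changes a (p ++ q)
  changes-++-≥ a []      q = z≤n
  changes-++-≥ a (b ∷ p) q = +-monoʳ-≤ (δ a b) (changes-++-≥ b p q)

  changes-++-≤ : ∀ a p q → changes a (p ++ q) ≤ changes a p + runCount q
  changes-++-≤ a []      []      = z≤n
  changes-++-≤ a []      (b ∷ q) = +-monoˡ-≤ (changes b q) (δ≤1 a b)
  changes-++-≤ a (b ∷ p) q       = begin
    δ a b + changes b (p ++ q)          ≤⟨ +-monoʳ-≤ (δ a b) (changes-++-≤ b p q) ⟩
    δ a b + (changes b p + runCount q)  ≡⟨ +-assoc (δ a b) _ _ ⟨
    δ a b + changes b p + runCount q    ∎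
    where open ≤-Reasoning

  runCount-++-≥ : ∀ p q → runCount p ≤ runCount (p ++ q)
  runCount-++-≥ []      q = z≤n
  runCount-++-≥ (a ∷ p) q = s≤s (changes-++-≥ a p q)

  runCount-++-≤ : ∀ p q → runCount (p ++ q) ≤ runCount p + runCount q
  runCount-++-≤ []      q = ≤-refl
  runCount-++-≤ (a ∷ p) q = s≤s (changes-++-≤ a p q)

  changes-linked : ∀ {a s} → Linked _≢_ (a ∷ s) → length s ≡ changes a s
  changes-linked [-]                  = refl
  changes-linked {a} (a≢b ∷ linked) = cong₂ _+_ (sym (δ-≢ a≢b)) (changes-linked linked)

  runCount-linked : ∀ {s} → Linked _≢_ s → runCount s ≡ length s
  runCount-linked []       = refl
  runCount-linked [-]      = refl
  runCount-linked (a≢b ∷ l) = cong suc (sym (changes-linked (a≢b ∷ l)))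

  runCount-gap : ∀ s t → length s ≡ length t → ∣ runCount s - runCount t ∣ ≤ 2 * mismatches s t
  runCount-gap s t eq = m≤n+o∧n≤m+o⇒∣m-n∣≤o
    (runCount-≤ s t eq)
    (subst (λ k → runCount t ≤ runCount s + 2 * k) (mismatches-comm t s) (runCount-≤ t s (sym eq)))

module RunDecomposition (M : MetricSpace) where

  open import Data.Nat using (_≤_; _<_)
  open import Data.Nat.Properties using (≤-trans; ≤-reflexive; n≤1+n; m≤m+n; +-comm; m≤n⇒m⊓n≡m; +-mono-≤; module ≤-Reasoning)
  open Strings M
  open RunCount _≟Σ_

  NonemptyRun : Run → Set
  NonemptyRun (_ , n) = 0 < n

  decode-runs : ∀ s → decode (runs s) ≡ s
  decode-runs []      = refl
  decode-runs (a ∷ s) with runs s | decode-runs s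
  ... | []           | ih = cong (a ∷_) ih
  ... | (b , n) ∷ rs | ih with a ≟Σ b
  ...   | yes refl = cong (a ∷_) ih
  ...   | no  _    = cong (a ∷_) ih

  runs-nonempty : ∀ s → All NonemptyRun (runs s)
  runs-nonempty []      = []
  runs-nonempty (a ∷ s) with runs s | runs-nonempty s
  ... | []           | _           = s≤s z≤n ∷ []
  ... | (b , n) ∷ rs | n>0 ∷ rs>0 with a ≟Σ b
  ...   | yes _ = s≤s z≤n ∷ rs>0
  ...   | no  _ = s≤s z≤n ∷ n>0 ∷ rs>0

  runs-linked : ∀ s → Linked (_≢_ on proj₁) (runs s)
  runs-linked []      = []
  runs-linked (a ∷ s) with runs s | runs-linked s
  ... | []           | _      = [-]
  ... | (b , n) ∷ rs | linked with a ≟Σ b | linked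
  ...   | yes _   | [-]        = [-]
  ...   | yes _   | b≢c ∷ rest = b≢c ∷ rest
  ...   | no  a≢b | _          = a≢b ∷ linked

  changes-decode : ∀ a L → All NonemptyRun L → changes a (decode L) ≡ changes a (map proj₁ L)
  changes-decode a []                []        = refl
  changes-decode a ((b , suc n) ∷ L) (_ ∷ L>0) =
    cong (δ a b +_) (trans (changes-replicate-++ b n (decode L)) (changes-decode b L L>0))

  runCount-decode : ∀ L → All NonemptyRun L → runCount (decode L) ≡ runCount (map proj₁ L)
  runCount-decode []                []        = refl
  runCount-decode ((b , suc n) ∷ L) (_ ∷ L>0) =
    cong suc (trans (changes-replicate-++ b n (decode L)) (changes-decode b L L>0))

  runCount-take-runs : ∀ s n → n ≤ length (runs s) → runCount (decode (take n (runs s))) ≡ n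
  runCount-take-runs s n n≤ = begin
    runCount (decode (take n (runs s)))     ≡⟨ runCount-decode _ (All.take⁺ n (runs-nonempty s)) ⟩
    runCount (map proj₁ (take n (runs s)))  ≡⟨ runCount-linked (Linked.map⁺ (Linked-take⁺ n (runs-linked s))) ⟩
    length (map proj₁ (take n (runs s)))    ≡⟨ List.length-map proj₁ (take n (runs s)) ⟩
    length (take n (runs s))                ≡⟨ List.length-take n (runs s) ⟩
    n ℕ.⊓ length (runs s)                   ≡⟨ m≤n⇒m⊓n≡m n≤ ⟩
    n                                       ∎
    where open ≡-Reasoning

  ExtendsRuns-nonempty : ∀ {L E} → ExtendsRuns L E → All NonemptyRun L → All NonemptyRun E
  ExtendsRuns-nonempty []                []        = []
  ExtendsRuns-nonempty ((_ , n≤m) ∷ ext) (n>0 ∷ L>0) = ≤-trans n>0 n≤m ∷ ExtendsRuns-nonempty ext L>0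

  runCount-expansion : ∀ u E → ExtendsRuns (runs u) E → runCount (decode E) ≡ runCount u
  runCount-expansion u E ext = begin
    runCount (decode E)               ≡⟨ runCount-decode E (ExtendsRuns-nonempty ext (runs-nonempty u)) ⟩
    runCount (map proj₁ E)            ≡⟨ cong runCount same-letters ⟨
    runCount (map proj₁ (runs u))     ≡⟨ runCount-decode (runs u) (runs-nonempty u) ⟨
    runCount (decode (runs u))        ≡⟨ cong runCount (decode-runs u) ⟩
    runCount u                        ∎
    where
    open ≡-Reasoning
    same-letters : map proj₁ (runs u) ≡ map proj₁ E
    same-letters = Pointwise-≡⇒≡ (Pointwise.map⁺ proj₁ proj₁ (Pointwise.map proj₁ ext))

  runCount-correspondence : ∀ {u v} (c : Correspondence u v) →
    ∣ runCount u - runCount v ∣ ≤ 2 * mismatches (Correspondence.ubar c) (Correspondence.vbar c)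
  runCount-correspondence {u} {v} c = subst₂ (λ p q → ∣ p - q ∣ ≤ 2 * mismatches ubar vbar)
    (runCount-expansion u eu eu-ext) (runCount-expansion v ev ev-ext)
    (runCount-gap ubar vbar same-length)
    where open Correspondence c

  runCount-yPrefix-suc : ∀ y r oy → r ≤ length (runs y) →
    r ≤ runCount (yPrefix y (suc r) oy) × runCount (yPrefix y (suc r) oy) ≤ suc r
  runCount-yPrefix-suc y r oy r≤ = lower , upper
    where
    prefix : List Carrier
    prefix = decode (take r (runs y))

    lower : r ≤ runCount (yPrefix y (suc r) oy)
    lower = subst (_≤ runCount (yPrefix y (suc r) oy)) (runCount-take-runs y r r≤) (runCount-++-≥ prefix _)

    upper-++ : ∀ q → runCount q ≤ 1 → runCount (prefix ++ q) ≤ suc r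
    upper-++ q q≤1 = begin
      runCount (prefix ++ q)          ≤⟨ runCount-++-≤ prefix q ⟩
      runCount prefix + runCount q    ≤⟨ +-mono-≤ (≤-reflexive (runCount-take-runs y r r≤)) q≤1 ⟩
      r + 1                           ≡⟨ +-comm r 1 ⟩
      suc r                           ∎
      where open ≤-Reasoning

    upper : runCount (yPrefix y (suc r) oy) ≤ suc r
    upper with at r (runs y)
    ... | just (b , _) = upper-++ _ (runCount-replicate b oy)
    ... | nothing      = upper-++ [] z≤n

  runCount-yPrefix : ∀ {x y rx ry oy} → Admissible x y rx ry oy → ∣ runCount (yPrefix y ry oy) - ry ∣ ≤ 1
  runCount-yPrefix {ry = zero}              _             = z≤n
  runCount-yPrefix {y = y} {ry = suc r} {oy} (_ , r<len , _)
    with runCount-yPrefix-suc y r oy (≤-trans (n≤1+n r) r<len)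
  ... | lower , upper =
    m≤n+o∧n≤m+o⇒∣m-n∣≤o (≤-trans upper (m≤m+n (suc r) 1)) (subst (suc r ≤_) (+-comm 1 _) (s≤s lower))

  admissible-rx : ∀ {x y rx ry oy} → Admissible x y rx ry oy → rx ≤ length (runs x)
  admissible-rx {ry = zero}  (rx≤ , _) = rx≤
  admissible-rx {ry = suc _} (rx≤ , _) = rx≤

-- The order on ℕ is opened only inside the modules above, so from here on _≤_ is the order on ℚ.
open import Data.Rational using (1ℚ; _≤_)
open import Data.Rational as ℚ using (ℚ; mkℚ; 0ℚ; ½; _/_; _-_; -_; *≤*)
open import Data.Rational.Properties
  using (normalize-coprime; /-cong; +-mono-≤; +-monoˡ-≤; *-monoʳ-≤-nonNeg; ≤-refl; ≤-trans; module ≤-Reasoning)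
open import Data.Rational.Solver using () renaming (module +-*-Solver to ℚ-Solver)
open import Data.Integer as ℤ using (+_)
import Data.Integer.Properties as ℤ
open import Data.Nat.Coprimality using (1-coprimeTo) renaming (sym to coprime-sym)
import Data.Nat.Properties as ℕ

fromℕ : ℕ → ℚ
fromℕ n = + n / 1

fromℕ≡mkℚ : ∀ n → fromℕ n ≡ mkℚ (+ n) 0 (coprime-sym (1-coprimeTo n))
fromℕ≡mkℚ n = normalize-coprime _

fromℕ-+ : ∀ m n → fromℕ (m + n) ≡ fromℕ m ℚ.+ fromℕ n
fromℕ-+ m n = begin
  + (m + n) / 1                           ≡⟨ /-cong (cong₂ ℤ._+_ (sym (ℤ.*-identityʳ (+ m))) (sym (ℤ.*-identityʳ (+ n)))) refl ⟩
  (+ m ℤ.* + 1 ℤ.+ + n ℤ.* + 1) / 1       ≡⟨ cong₂ ℚ._+_ (fromℕ≡mkℚ m) (fromℕ≡mkℚ n) ⟨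
  fromℕ m ℚ.+ fromℕ n                     ∎
  where open ≡-Reasoning

fromℕ-mono-≤ : ∀ {m n} → m ℕ.≤ n → fromℕ m ≤ fromℕ n
fromℕ-mono-≤ {m} {n} m≤n rewrite fromℕ≡mkℚ m | fromℕ≡mkℚ n =
  *≤* (ℤ.*-monoʳ-≤-nonNeg (+ 1) (ℤ.+≤+ m≤n))

half-pred-≤ : ∀ {k} m → k ℕ.≤ 2 * m + 1 → (fromℕ k - 1ℚ) ℚ.* ½ ≤ fromℕ m
half-pred-≤ {k} m k≤ = begin
  (fromℕ k - 1ℚ) ℚ.* ½                                  ≤⟨ *-monoʳ-≤-nonNeg ½ (+-monoˡ-≤ (- 1ℚ) (fromℕ-mono-≤ k≤)) ⟩
  (fromℕ (m + (m + 0) + 1) - 1ℚ) ℚ.* ½                  ≡⟨ cong (λ q → (q - 1ℚ) ℚ.* ½) fromℕ-2m+1 ⟩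
  (fromℕ m ℚ.+ fromℕ m ℚ.+ 1ℚ - 1ℚ) ℚ.* ½               ≡⟨ solve 1 (λ q → (q :+ q :+ con 1ℚ :- con 1ℚ) :* con ½ := q) refl (fromℕ m) ⟩
  fromℕ m                                               ∎
  where
  open ≤-Reasoning
  open ℚ-Solver
  fromℕ-2m+1 : fromℕ (m + (m + 0) + 1) ≡ fromℕ m ℚ.+ fromℕ m ℚ.+ 1ℚ
  fromℕ-2m+1 = begin-equality
    fromℕ (m + (m + 0) + 1)                ≡⟨ fromℕ-+ (m + (m + 0)) 1 ⟩
    fromℕ (m + (m + 0)) ℚ.+ 1ℚ             ≡⟨ cong (ℚ._+ 1ℚ) (fromℕ-+ m (m + 0)) ⟩
    fromℕ m ℚ.+ fromℕ (m + 0) ℚ.+ 1ℚ       ≡⟨ cong (λ n → fromℕ m ℚ.+ fromℕ n ℚ.+ 1ℚ) (ℕ.+-identityʳ m) ⟩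
    fromℕ m ℚ.+ fromℕ m ℚ.+ 1ℚ             ∎

module Cost (M : MetricSpace) where

  open Strings M
  open RunCount _≟Σ_

  δ-≤-d : (∀ a b → a ≢ b → 1ℚ ≤ d a b) → ∀ a b → fromℕ (δ a b) ≤ d a b
  -- Splitting on a ≟Σ b in a helper rather than by a with-abstraction keeps the goal, which
  -- contains fromℕ, from being normalised (very slowly).
  δ-≤-d d≥1 a b = from-dec (a ≟Σ b)
    where
    from-dec : Dec (a ≡ b) → fromℕ (δ a b) ≤ d a b
    from-dec (yes refl) = subst₂ _≤_ (cong fromℕ (sym (δ-refl a))) (sym (d-refl a)) ≤-refl
    from-dec (no a≢b)   = subst (_≤ d a b) (cong fromℕ (sym (δ-≢ a≢b))) (d≥1 a b a≢b)

  mismatches-≤-cost : (∀ a b → a ≢ b → 1ℚ ≤ d a b) →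
    ∀ s t → fromℕ (mismatches s t) ≤ foldr ℚ._+_ 0ℚ (zipWith d s t)
  mismatches-≤-cost d≥1 []      _       = ≤-refl
  mismatches-≤-cost d≥1 (_ ∷ _) []      = ≤-refl
  mismatches-≤-cost d≥1 (a ∷ s) (b ∷ t) = begin
    fromℕ (δ a b + mismatches s t)               ≡⟨ fromℕ-+ (δ a b) (mismatches s t) ⟩
    fromℕ (δ a b) ℚ.+ fromℕ (mismatches s t)     ≤⟨ +-mono-≤ (δ-≤-d d≥1 a b) (mismatches-≤-cost d≥1 s t) ⟩
    d a b ℚ.+ foldr ℚ._+_ 0ℚ (zipWith d s t)     ∎
    where open ≤-Reasoning

mainTheorem4 : (M : MetricSpace) →
    (∀ a b → a ≢ b → 1ℚ ≤ MetricSpace.d M a b) →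
    (x y : List (MetricSpace.Carrier M)) (rx ry oy : ℕ) →
    Strings.Admissible M x y rx ry oy →
    (c : Strings.Correspondence M (Strings.xPrefix M x rx) (Strings.yPrefix M y ry oy)) →
    Strings.NotExtendedᵥ M (ry ∸ 1) c →
    Strings.bound M rx ry ≤ Strings.cost M c
-- The bound holds for every correspondence.
mainTheorem4 M d≥1 x y rx ry oy adm c _ =
  ≤-trans (half-pred-≤ m ∣rx-ry∣≤2m+1) (mismatches-≤-cost d≥1 ubar vbar)
  where
  open Strings M
  open RunCount _≟Σ_
  open RunDecomposition M
  open Cost M
  open Correspondence c

  m : ℕ
  m = mismatches ubar vbar

  R : ℕ
  R = runCount (yPrefix y ry oy)

  ∣rx-ry∣≤2m+1 : ∣ rx - ry ∣ ℕ.≤ 2 * m + 1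
  ∣rx-ry∣≤2m+1 = ℕ.≤-trans (ℕ.∣-∣-triangle rx R ry) (ℕ.+-mono-≤ ∣rx-R∣≤2m (runCount-yPrefix adm))
    where
    ∣rx-R∣≤2m : ∣ rx - R ∣ ℕ.≤ 2 * m
    ∣rx-R∣≤2m = subst (λ k → ∣ k - R ∣ ℕ.≤ 2 * m) (runCount-take-runs x rx (admissible-rx adm)) (runCount-correspondence c)
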